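{- Let $G=(V,E)$ be a finite simple undirected graph and let $k\ge 3$ be an integer. The vertex sets of the maximal connected $k$-gonal subgraphs of $G$ are exactly the nontrivial equivalence classes of the relation $K_k$ (vertex $k$-gonal connectivity) on $V$.
   Context: A $(k)$-gone of $G$ is a subgraph of $G$ isomorphic to a cycle $C_s$ for some $s$ with $3\le s\le k$. A subgraph $H$ of $G$ is $k$-gonal if each of its vertices and each of its edges belongs to at least one $(k)$-gone contained in $H$. A (vertex) $k$-gonal chain connecting $u$ with $v$ is a finite sequence $(C_1,\dots,C_s)$ of $(k)$-gones of $G$ with $u\in V(C_1)$, $v\in V(C_s)$, and $V(C_{i-1})\cap V(C_i)\neq\emptyset$ for $i=2,\dots,s$. The relation $K_k$ on $V$ is defined by $u\,K_k\,v$ iff $u=v$ or there is a vertex $k$-gonal chain connecting $u$ with $v$; it is an equivalence relation. An equivalence class is trivial iff it consists of a single vertex. -}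

module Defs where

open import Data.Nat using (ℕ; zero; suc; _≤_; _<?_)
open import Data.Fin using (Fin; zero; suc; toℕ; fromℕ<; fromℕ; inject₁)
open import Data.Fin.Subset using (Subset; _∈_)
open import Data.Bool using (Bool; true; false)
open import Data.Product using (Σ; ∃; _×_; _,_)
open import Data.Sum using (_⊎_)
open import Relation.Binary.PropositionalEquality using (_≡_; _≢_)
open import Relation.Nullary using (yes; no; ¬_)
open import Function.Definitions using (Injective)

record Graph (n : ℕ) : Set where
  field
    adj   : Fin n → Fin n → Bool
    sym   : ∀ u v → adj u v ≡ adj v u
    irrefl : ∀ u → adj u u ≡ false
open Graph public

next : ∀ {s} → Fin s → Fin s
next {suc m} i with suc (toℕ i) <? suc m
... | yes p = fromℕ< p
... | no _  = zero

record Subgraph {n : ℕ} (G : Graph n) : Set where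
  field
    verts    : Subset n
    edges    : Fin n → Fin n → Bool
    edge-sym : ∀ u v → edges u v ≡ edges v u
    edge-adj : ∀ u v → edges u v ≡ true → adj G u v ≡ true
    edge-src : ∀ u v → edges u v ≡ true → u ∈ verts
open Subgraph public

-- A (k)-gone of G: a subgraph isomorphic to the cycle C_s, 3 ≤ s ≤ k,
-- given by an injective cyclic sequence of vertices f 0, f 1, …, f (s-1)
-- with f i adjacent to f (i+1 mod s).
record Gone {n : ℕ} (G : Graph n) (k : ℕ) : Set where
  field
    len    : ℕ
    len≥3  : 3 ≤ len
    len≤k  : len ≤ k
    f      : Fin len → Fin n
    f-inj  : Injective _≡_ _≡_ f
    f-adj  : ∀ i → adj G (f i) (f (next i)) ≡ true
open Gone public

module _ {n : ℕ} {G : Graph n} {k : ℕ} where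

  OnGone : Fin n → Gone G k → Set
  OnGone v C = ∃ λ i → f C i ≡ v

  EdgeOfGone : Fin n → Fin n → Gone G k → Set
  EdgeOfGone u v C = ∃ λ i → (f C i ≡ u × f C (next i) ≡ v) ⊎ (f C i ≡ v × f C (next i) ≡ u)

  GoneIn : Gone G k → Subgraph G → Set
  GoneIn C H = ∀ i → (f C i ∈ verts H) × (edges H (f C i) (f C (next i)) ≡ true)

KGonal : ∀ {n} (G : Graph n) (k : ℕ) → Subgraph G → Set
KGonal G k H =
  (∀ v → v ∈ verts H → Σ (Gone G k) λ C → GoneIn C H × OnGone v C) ×
  (∀ u v → edges H u v ≡ true → Σ (Gone G k) λ C → GoneIn C H × EdgeOfGone u v C)

data Walk {n} {G : Graph n} (H : Subgraph G) : Fin n → Fin n → Set where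
  here : ∀ {u} → Walk H u u
  step : ∀ {u w v} → edges H u w ≡ true → Walk H w v → Walk H u v

Connected : ∀ {n} {G : Graph n} → Subgraph G → Set
Connected {n} H = (∃ λ v → v ∈ verts H) × (∀ u v → u ∈ verts H → v ∈ verts H → Walk H u v)

_⊑_ : ∀ {n} {G : Graph n} → Subgraph G → Subgraph G → Set
_⊑_ {n} H H' = (∀ (v : Fin n) → v ∈ verts H → v ∈ verts H') × (∀ u v → edges H u v ≡ true → edges H' u v ≡ true)

MaxConnKGonal : ∀ {n} (G : Graph n) (k : ℕ) → Subgraph G → Set
MaxConnKGonal G k H =
  Connected H × KGonal G k H ×
  (∀ H' → Connected H' → KGonal G k H' → H ⊑ H' → H' ⊑ H)

record Chain {n} (G : Graph n) (k : ℕ) (u v : Fin n) : Set where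
  field
    s      : ℕ
    C      : Fin (suc s) → Gone G k
    start  : OnGone u (C zero)
    end    : OnGone v (C (fromℕ s))
    linked : ∀ (i : Fin s) → ∃ λ w → OnGone w (C (inject₁ i)) × OnGone w (C (suc i))

K : ∀ {n} (G : Graph n) (k : ℕ) → Fin n → Fin n → Set
K G k u v = u ≡ v ⊎ Chain G k u v

IsClass : ∀ {n} (G : Graph n) (k : ℕ) → Subset n → Set
IsClass {n} G k S = ∃ λ (u : Fin n) → ∀ v → (v ∈ S → K G k u v) × (K G k u v → v ∈ S)

NontrivialClass : ∀ {n} (G : Graph n) (k : ℕ) → Subset n → Set
NontrivialClass {n} G k S =
  IsClass G k S × (∃ λ (v : Fin n) → ∃ λ (w : Fin n) → v ∈ S × w ∈ S × v ≢ w)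

{-# OPTIONS --safe #-}
-- A maximal connected k-gonal subgraph H absorbs every (k)-gone meeting it, because adding the
-- gone to H keeps it connected and k-gonal.  So V(H) is closed under K_k; conversely a walk in H
-- is a chain of (k)-gones through its edges, so V(H) is a single class, and it is nontrivial since
-- a gone has at least three vertices.  A nontrivial class S spans the subgraph whose edges are the
-- edges of (k)-gones meeting S: such gones lie inside S, chains become walks, every vertex of S is
-- K_k-related to another one and hence lies on a gone, and a connected k-gonal supergraph cannot
-- leave S since its walks are again chains.
module Submission where

open import Defs
open import Level using (0ℓ)
open import Data.Bool using (true)
open import Data.Bool.Properties using () renaming (_≟_ to _≟ᵇ_)
import Data.Nat as ℕ
open import Data.Nat using (ℕ; suc; _≤_; _<_; _<?_; _≤?_; s≤s; s≤s⁻¹; s<s)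
open import Data.Nat.Properties using (anyUpTo?; ≤-trans; n≤1+n)
open import Data.Fin using (Fin; zero; suc; toℕ; inject₁; fromℕ; _≟_; finToFun; funToFin)
open import Data.Fin.Properties
  using (any?; all?; toℕ-injective; toℕ-fromℕ<; toℕ-inject₁; toℕ<n; finToFun-funToFin; 0≢1+n)
open import Data.Fin.Subset using (Subset; _∈_; _∪_)
open import Data.Fin.Subset.Properties using (_∈?_; x∈p∪q⁺; x∈p∪q⁻)
open import Data.Vec using (tabulate)
open import Data.Vec.Properties using (lookup∘tabulate; lookup⇒[]=; []=⇒lookup)
open import Data.Vec.Functional using (_∷_)
import Data.Product
open import Data.Product using (Σ; ∃; ∃₂; _×_; _,_; proj₁; proj₂)
import Data.Sum
open import Data.Sum using (_⊎_; inj₁; inj₂; [_,_]′)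
open import Function using (_∘_)
open import Function.Bundles using (_⇔_; mk⇔; Equivalence)
open import Function.Definitions using (Injective)
open import Relation.Binary using (Rel; Symmetric; Decidable)
open import Relation.Binary.Construct.Closure.ReflexiveTransitive
  using (Star; ε; _◅_; _◅◅_; reverse)
open import Relation.Binary.PropositionalEquality as ≡
  using (_≡_; _≢_; _≗_; refl; cong; subst; subst₂)
open import Relation.Nullary using (Dec; yes; no; does; contradiction)
open import Relation.Nullary.Decidable using (map′; _×-dec_; _⊎-dec_; _→-dec_; dec-true; does-⇔)
open import Relation.Unary using (Pred)
import Relation.Unary as U

dec-true⁻¹ : ∀ {A : Set} (a? : Dec A) → does a? ≡ true → A
dec-true⁻¹ (yes a) _ = a

next-inject₁ : ∀ {m} (i : Fin m) → next (inject₁ i) ≡ suc i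
next-inject₁ {m} i with suc (toℕ (inject₁ i)) <? suc m
... | yes p = toℕ-injective (≡.trans (toℕ-fromℕ< p) (cong suc (toℕ-inject₁ i)))
... | no ¬p = contradiction (s<s (subst (_< m) (≡.sym (toℕ-inject₁ i)) (toℕ<n i))) ¬p

-- finToFun ∘ funToFin is the identity only pointwise, hence the invariance hypothesis on P.
any-fun? : ∀ {m n} {P : (Fin m → Fin n) → Set} →
           (∀ {g h} → g ≗ h → P g → P h) → U.Decidable P → Dec (∃ P)
any-fun? resp P? =
  map′ (λ (i , p) → finToFun i , p)
       (λ (g , p) → funToFin g , resp (≡.sym ∘ finToFun-funToFin g) p)
       (any? (P? ∘ finToFun))

∈-tabulate-does : ∀ {n} {P : Pred (Fin n) 0ℓ} (P? : U.Decidable P) {x} →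
                  x ∈ tabulate (does ∘ P?) ⇔ P x
∈-tabulate-does P? {x} = mk⇔
  (λ x∈ → dec-true⁻¹ (P? x) (≡.trans (≡.sym (lookup∘tabulate _ x)) ([]=⇒lookup x∈)))
  (λ px → lookup⇒[]= x _ (≡.trans (lookup∘tabulate _ x) (dec-true (P? x) px)))

injective⇒distinct : ∀ {m} {A : Set} (g : Fin m → A) → Injective _≡_ _≡_ g → 2 ≤ m →
                     ∃₂ λ i j → g i ≢ g j
injective⇒distinct g g-inj (s≤s (s≤s _)) = zero , suc zero , 0≢1+n ∘ g-inj

EdgeOn : ∀ {n} → Fin n → Fin n → ∀ {m} → (Fin m → Fin n) → Set
EdgeOn u v g = ∃ λ i → (g i ≡ u × g (next i) ≡ v) ⊎ (g i ≡ v × g (next i) ≡ u)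

edgeOn? : ∀ {n} (u v : Fin n) {m} (g : Fin m → Fin n) → Dec (EdgeOn u v g)
edgeOn? u v g = any? λ i →
  ((g i ≟ u) ×-dec (g (next i) ≟ v)) ⊎-dec ((g i ≟ v) ×-dec (g (next i) ≟ u))

module _ {A : Set} {R : Rel A 0ℓ} where

  star-along : ∀ {m} (g : Fin (suc m) → A) → (∀ i → R (g (inject₁ i)) (g (suc i))) →
               ∀ i → Star R (g zero) (g i)
  star-along g steps zero = ε
  star-along {suc m} g steps (suc i) = steps zero ◅ star-along (g ∘ suc) (steps ∘ suc) i

  star-cycle : Symmetric R → ∀ {m} (g : Fin m → A) → (∀ i → R (g i) (g (next i))) →
               ∀ i j → Star R (g i) (g j)
  star-cycle R-sym {suc m} g steps i j =
    reverse R-sym (star-along g steps′ i) ◅◅ star-along g steps′ j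
    where
    steps′ : ∀ i → R (g (inject₁ i)) (g (suc i))
    steps′ i = subst (R (g (inject₁ i)) ∘ g) (next-inject₁ i) (steps (inject₁ i))

module _ {n : ℕ} {G : Graph n} where

  EdgeIn : Subgraph G → Rel (Fin n) 0ℓ
  EdgeIn H u v = edges H u v ≡ true

  Path : Subgraph G → Rel (Fin n) 0ℓ
  Path H = Star (EdgeIn H)

  walk⇒path : ∀ {H u v} → Walk H u v → Path H u v
  walk⇒path here       = ε
  walk⇒path (step e w) = e ◅ walk⇒path w

  path⇒walk : ∀ {H u v} → Path H u v → Walk H u v
  path⇒walk ε        = here
  path⇒walk (e ◅ es) = step e (path⇒walk es)

  edgeIn-sym : ∀ H → Symmetric (EdgeIn H)
  edgeIn-sym H {u} {v} e = ≡.trans (edge-sym H v u) e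

  path-sym : ∀ H → Symmetric (Path H)
  path-sym H = reverse (edgeIn-sym H)

  ⊑-path : ∀ H H′ {u v} → H ⊑ H′ → Path H u v → Path H′ u v
  ⊑-path H H′ H⊑H′ ε        = ε
  ⊑-path H H′ H⊑H′ (e ◅ es) = proj₂ H⊑H′ _ _ e ◅ ⊑-path H H′ H⊑H′ es

  connected-path : ∀ H {u v} → Connected H → u ∈ verts H → v ∈ verts H → Path H u v
  connected-path H (_ , walk) u∈ v∈ = walk⇒path (walk _ _ u∈ v∈)

  decSubgraph : (V : Subset n) (E : Rel (Fin n) 0ℓ) → Decidable E → Symmetric E →
                (∀ {u v} → E u v → adj G u v ≡ true) → (∀ {u v} → E u v → u ∈ V) → Subgraph G
  decSubgraph V E E? E-sym E-adj E-src = record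
    { verts    = V
    ; edges    = λ u v → does (E? u v)
    ; edge-sym = λ u v → does-⇔ (mk⇔ E-sym E-sym) (E? u v) (E? v u)
    ; edge-adj = λ u v → E-adj ∘ dec-true⁻¹ (E? u v)
    ; edge-src = λ u v → E-src ∘ dec-true⁻¹ (E? u v)
    }

module _ {n : ℕ} (G : Graph n) (k : ℕ) where

  private variable
    u v : Fin n

  OnCommonGone : Rel (Fin n) 0ℓ
  OnCommonGone u v = Σ (Gone G k) λ C → OnGone u C × OnGone v C

  onCommonGone-sym : Symmetric OnCommonGone
  onCommonGone-sym (C , u∈C , v∈C) = C , v∈C , u∈C

  onGone? : ∀ v (C : Gone G k) → Dec (OnGone v C)
  onGone? v C = any? λ i → f C i ≟ v

  edgeOfGone-sym : (C : Gone G k) → EdgeOfGone u v C → EdgeOfGone v u C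
  edgeOfGone-sym C (i , inj₁ e) = i , inj₂ e
  edgeOfGone-sym C (i , inj₂ e) = i , inj₁ e

  edgeOfGone-src : (C : Gone G k) → EdgeOfGone u v C → OnGone u C
  edgeOfGone-src C (i , inj₁ (u≡ , _)) = i , u≡
  edgeOfGone-src C (i , inj₂ (_ , u≡)) = next i , u≡

  edgeOfGone-common : (C : Gone G k) → EdgeOfGone u v C → OnCommonGone u v
  edgeOfGone-common C uv = C , edgeOfGone-src C uv , edgeOfGone-src C (edgeOfGone-sym C uv)

  edgeOfGone-adj : (C : Gone G k) → EdgeOfGone u v C → adj G u v ≡ true
  edgeOfGone-adj C (i , inj₁ (u≡ , v≡)) = subst₂ (λ x y → adj G x y ≡ true) u≡ v≡ (f-adj C i)
  edgeOfGone-adj C (i , inj₂ vu)        = ≡.trans (Graph.sym G _ _) (edgeOfGone-adj C (i , inj₁ vu))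

  gone-distinct : (C : Gone G k) → ∃₂ λ i j → f C i ≢ f C j
  gone-distinct C = injective⇒distinct (f C) (f-inj C) (≤-trans (n≤1+n 2) (len≥3 C))

  goneIn-path : (C : Gone G k) (H : Subgraph G) → ∀ {u v} →
                GoneIn C H → OnGone u C → OnGone v C → Path H u v
  goneIn-path C H C⊆H (i , refl) (j , refl) = star-cycle (edgeIn-sym H) (f C) (proj₂ ∘ C⊆H) i j

  ⊑-goneIn : (C : Gone G k) {H H′ : Subgraph G} → H ⊑ H′ → GoneIn C H → GoneIn C H′
  ⊑-goneIn C (V⊆ , E⊆) C⊆H i = V⊆ _ (proj₁ (C⊆H i)) , E⊆ _ _ (proj₂ (C⊆H i))

  linked-gones⇒star : ∀ {s} (C : Fin (suc s) → Gone G k) →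
                      OnGone u (C zero) → OnGone v (C (fromℕ s)) →
                      (∀ i → ∃ λ w → OnGone w (C (inject₁ i)) × OnGone w (C (suc i))) →
                      Star OnCommonGone u v
  linked-gones⇒star {s = ℕ.zero}  C u∈ v∈ linked = (C zero , u∈ , v∈) ◅ ε
  linked-gones⇒star {s = ℕ.suc s} C u∈ v∈ linked =
    let (_ , w∈₀ , w∈₁) = linked zero
    in (C zero , u∈ , w∈₀) ◅ linked-gones⇒star (C ∘ suc) w∈₁ v∈ (linked ∘ suc)

  chain⇒star : Chain G k u v → Star OnCommonGone u v
  chain⇒star ch = linked-gones⇒star (Chain.C ch) (Chain.start ch) (Chain.end ch) (Chain.linked ch)

  K⇒star : K G k u v → Star OnCommonGone u v
  K⇒star (inj₁ refl) = ε
  K⇒star (inj₂ ch)   = chain⇒star ch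

  cons-chain : ∀ {w} → OnCommonGone u w → K G k w v → Chain G k u v
  cons-chain (D , u∈ , w∈) (inj₁ refl) =
    record { s = 0 ; C = λ _ → D ; start = u∈ ; end = w∈ ; linked = λ () }
  cons-chain {w = w} (D , u∈ , w∈) (inj₂ ch) = record
    { s      = ℕ.suc (Chain.s ch)
    ; C      = D ∷ Chain.C ch
    ; start  = u∈
    ; end    = Chain.end ch
    ; linked = λ { zero → w , w∈ , Chain.start ch ; (suc i) → Chain.linked ch i }
    }

  star⇒K : Star OnCommonGone u v → K G k u v
  star⇒K ε        = inj₁ refl
  star⇒K (c ◅ cs) = inj₂ (cons-chain c (star⇒K cs))

  kGonal-path⇒star : (H : Subgraph G) → KGonal G k H → Path H u v → Star OnCommonGone u v
  kGonal-path⇒star H H-gonal ε        = ε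
  kGonal-path⇒star H H-gonal (e ◅ es) =
    let (D , _ , uw∈D) = proj₂ H-gonal _ _ e
    in edgeOfGone-common D uw∈D ◅ kGonal-path⇒star H H-gonal es

  goneVerts : Gone G k → Subset n
  goneVerts C = tabulate (λ v → does (onGone? v C))

  goneVerts⁺ : (C : Gone G k) → OnGone v C → v ∈ goneVerts C
  goneVerts⁺ C = Equivalence.from (∈-tabulate-does (λ v → onGone? v C))

  goneVerts⁻ : (C : Gone G k) → v ∈ goneVerts C → OnGone v C
  goneVerts⁻ C = Equivalence.to (∈-tabulate-does (λ v → onGone? v C))

  ExtendedEdge : Subgraph G → Gone G k → Rel (Fin n) 0ℓ
  ExtendedEdge H C u v = EdgeIn H u v ⊎ EdgeOfGone u v C

  extendedEdge? : (H : Subgraph G) (C : Gone G k) → Decidable (ExtendedEdge H C)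
  extendedEdge? H C u v = (edges H u v ≟ᵇ true) ⊎-dec edgeOn? u v (f C)

  extend : Subgraph G → Gone G k → Subgraph G
  extend H C = decSubgraph (verts H ∪ goneVerts C) (ExtendedEdge H C) (extendedEdge? H C)
    (Data.Sum.map (edgeIn-sym H) (edgeOfGone-sym C))
    [ edge-adj H _ _ , edgeOfGone-adj C ]′
    (x∈p∪q⁺ ∘ [ inj₁ ∘ edge-src H _ _ , inj₂ ∘ goneVerts⁺ C ∘ edgeOfGone-src C ]′)

  ⊑-extend : (H : Subgraph G) (C : Gone G k) → H ⊑ extend H C
  ⊑-extend H C = (λ _ → x∈p∪q⁺ ∘ inj₁) , λ u v → dec-true (extendedEdge? H C u v) ∘ inj₁

  goneIn-extend : (H : Subgraph G) (C : Gone G k) → GoneIn C (extend H C)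
  goneIn-extend H C i =
    x∈p∪q⁺ (inj₂ (goneVerts⁺ C (i , refl))) ,
    dec-true (extendedEdge? H C _ _) (inj₂ (i , inj₁ (refl , refl)))

  extend-verts⁻ : (H : Subgraph G) (C : Gone G k) →
                  v ∈ verts (extend H C) → v ∈ verts H ⊎ OnGone v C
  extend-verts⁻ H C = Data.Sum.map₂ (goneVerts⁻ C) ∘ x∈p∪q⁻ (verts H) (goneVerts C)

  extend-connected : (H : Subgraph G) (C : Gone G k) →
                     Connected H → u ∈ verts H → OnGone u C → Connected (extend H C)
  extend-connected {u = u} H C H-conn u∈H u∈C =
    (u , proj₁ (⊑-extend H C) u u∈H) ,
    λ a b a∈ b∈ → path⇒walk (to-u a∈ ◅◅ path-sym (extend H C) (to-u b∈))
    where
    to-u : ∀ {v} → v ∈ verts (extend H C) → Path (extend H C) v u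
    to-u v∈ with extend-verts⁻ H C v∈
    ... | inj₁ v∈H = ⊑-path H (extend H C) (⊑-extend H C) (connected-path H H-conn v∈H u∈H)
    ... | inj₂ v∈C = goneIn-path C (extend H C) (goneIn-extend H C) v∈C u∈C

  extend-kGonal : (H : Subgraph G) (C : Gone G k) → KGonal G k H → KGonal G k (extend H C)
  extend-kGonal H C (H-verts , H-edges) =
    (λ v v∈ → [ (λ v∈H → let (D , D⊆H , v∈D) = H-verts v v∈H in D , lift D D⊆H , v∈D)
              , (λ v∈C → C , goneIn-extend H C , v∈C)
              ]′ (extend-verts⁻ H C v∈)) ,
    (λ u v e → [ (λ e∈H → let (D , D⊆H , uv∈D) = H-edges u v e∈H in D , lift D D⊆H , uv∈D)
               , (λ uv∈C → C , goneIn-extend H C , uv∈C)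
               ]′ (dec-true⁻¹ (extendedEdge? H C u v) e))
    where
    lift : (D : Gone G k) → GoneIn D H → GoneIn D (extend H C)
    lift D = ⊑-goneIn D {H} {extend H C} (⊑-extend H C)

  maximal-absorbs : (H : Subgraph G) → MaxConnKGonal G k H →
                    u ∈ verts H → OnCommonGone u v → v ∈ verts H
  maximal-absorbs {v = v} H (H-conn , H-gonal , H-max) u∈H (C , u∈C , v∈C) =
    proj₁ (H-max (extend H C) (extend-connected H C H-conn u∈H u∈C)
                 (extend-kGonal H C H-gonal) (⊑-extend H C))
          v (x∈p∪q⁺ (inj₂ (goneVerts⁺ C v∈C)))

  maximal-closed : (H : Subgraph G) → MaxConnKGonal G k H →
                   u ∈ verts H → Star OnCommonGone u v → v ∈ verts H
  maximal-closed H H-max u∈H ε        = u∈H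
  maximal-closed H H-max u∈H (c ◅ cs) = maximal-closed H H-max (maximal-absorbs H H-max u∈H c) cs

  maximal⇒nontrivialClass : (H : Subgraph G) → MaxConnKGonal G k H → NontrivialClass G k (verts H)
  maximal⇒nontrivialClass H H-max@(H-conn@((v₀ , v₀∈) , _) , H-gonal , _) =
    (v₀ , λ v → (λ v∈ → star⇒K (kGonal-path⇒star H H-gonal (connected-path H H-conn v₀∈ v∈)))
              , (λ v₀Kv → maximal-closed H H-max v₀∈ (K⇒star v₀Kv))) ,
    (let (C , C⊆H , _)    = proj₁ H-gonal v₀ v₀∈
         (i , j , fi≢fj) = gone-distinct C
     in f C i , f C j , proj₁ (C⊆H i) , proj₁ (C⊆H j) , fi≢fj)

  GonalEdge : Rel (Fin n) 0ℓ
  GonalEdge u v = Σ (Gone G k) (EdgeOfGone u v)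

  CycleThrough : Fin n → Fin n → ∀ {m} → (Fin m → Fin n) → Set
  CycleThrough u v g =
    (∀ i j → g i ≡ g j → i ≡ j) × (∀ i → adj G (g i) (g (next i)) ≡ true) × EdgeOn u v g

  cycleThrough-resp : ∀ {m} {g h : Fin m → Fin n} → g ≗ h → CycleThrough u v g → CycleThrough u v h
  cycleThrough-resp {g = g} {h} g≗h (g-inj , g-adj , (i , uv∈g)) =
    (λ i j hi≡hj → g-inj i j (≡.trans (g≗h i) (≡.trans hi≡hj (≡.sym (g≗h j))))) ,
    (λ i → subst₂ (λ x y → adj G x y ≡ true) (g≗h i) (g≗h (next i)) (g-adj i)) ,
    (i , Data.Sum.map moved moved uv∈g)
    where
    moved : ∀ {x y} → g i ≡ x × g (next i) ≡ y → h i ≡ x × h (next i) ≡ y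
    moved = Data.Product.map (≡.trans (≡.sym (g≗h i))) (≡.trans (≡.sym (g≗h (next i))))

  cycleThrough? : ∀ u v {m} → U.Decidable (CycleThrough u v {m})
  cycleThrough? u v g =
    all? (λ i → all? λ j → (g i ≟ g j) →-dec (i ≟ j)) ×-dec
    all? (λ i → adj G (g i) (g (next i)) ≟ᵇ true) ×-dec
    edgeOn? u v g

  -- Edges of a subgraph are Boolean, so lying on a (k)-gone must be decided: by brute force over
  -- all lengths below k + 1 and all vertex sequences of that length.
  gonalEdge? : Decidable GonalEdge
  gonalEdge? u v = map′ toGone fromGone
    (anyUpTo? (λ m → (3 ≤? m) ×-dec any-fun? cycleThrough-resp (cycleThrough? u v)) (suc k))
    where
    toGone : (∃ λ m → m < suc k × 3 ≤ m × ∃ (CycleThrough u v {m})) → GonalEdge u v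
    toGone (m , m<1+k , 3≤m , g , g-inj , g-adj , uv∈g) = record
      { len = m ; len≥3 = 3≤m ; len≤k = s≤s⁻¹ m<1+k ; f = g ; f-inj = g-inj _ _ ; f-adj = g-adj }
      , uv∈g
    fromGone : GonalEdge u v → ∃ λ m → m < suc k × 3 ≤ m × ∃ (CycleThrough u v {m})
    fromGone (C , uv∈C) = len C , s≤s (len≤k C) , len≥3 C , f C , (λ _ _ → f-inj C) , f-adj C , uv∈C

  SpanEdge : Subset n → Rel (Fin n) 0ℓ
  SpanEdge S u v = GonalEdge u v × u ∈ S × v ∈ S

  gonalSpan : Subset n → Subgraph G
  gonalSpan S = decSubgraph S (SpanEdge S) (λ u v → gonalEdge? u v ×-dec u ∈? S ×-dec v ∈? S)
    (λ ((C , uv∈C) , u∈ , v∈) → (C , edgeOfGone-sym C uv∈C) , v∈ , u∈)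
    (λ ((C , uv∈C) , _) → edgeOfGone-adj C uv∈C)
    (proj₁ ∘ proj₂)

  star-firstGone : u ≢ v → Star OnCommonGone u v → Σ (Gone G k) (OnGone u)
  star-firstGone u≢u ε                = contradiction refl u≢u
  star-firstGone _   ((C , u∈C , _) ◅ _) = C , u∈C

  module _ {S : Subset n} (S-class : IsClass G k S) where

    root-star : v ∈ S → Star OnCommonGone (proj₁ S-class) v
    root-star v∈ = K⇒star (proj₁ (proj₂ S-class _) v∈)

    class-star : u ∈ S → v ∈ S → Star OnCommonGone u v
    class-star u∈ v∈ = reverse onCommonGone-sym (root-star u∈) ◅◅ root-star v∈

    class-closed : u ∈ S → Star OnCommonGone u v → v ∈ S
    class-closed u∈ uv = proj₂ (proj₂ S-class _) (star⇒K (root-star u∈ ◅◅ uv))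

    goneIn-span : (C : Gone G k) → u ∈ S → OnGone u C → GoneIn C (gonalSpan S)
    goneIn-span C u∈ u∈C i =
      on-S i , dec-true (gonalEdge? _ _ ×-dec _ ∈? S ×-dec _ ∈? S)
                        ((C , i , inj₁ (refl , refl)) , on-S i , on-S (next i))
      where
      on-S : ∀ j → f C j ∈ S
      on-S j = class-closed u∈ ((C , u∈C , (j , refl)) ◅ ε)

    star⇒span-path : u ∈ S → Star OnCommonGone u v → Path (gonalSpan S) u v
    star⇒span-path u∈ ε                      = ε
    star⇒span-path u∈ ((C , u∈C , w∈C) ◅ cs) =
      goneIn-path C (gonalSpan S) (goneIn-span C u∈ u∈C) u∈C w∈C ◅◅
      star⇒span-path (class-closed u∈ ((C , u∈C , w∈C) ◅ ε)) cs

    span-connected : u ∈ S → Connected (gonalSpan S)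
    span-connected u∈ =
      (_ , u∈) , λ a b a∈ b∈ → path⇒walk (star⇒span-path a∈ (class-star a∈ b∈))

    span-edges-gonal : ∀ a b → EdgeIn (gonalSpan S) a b →
                       Σ (Gone G k) λ C → GoneIn C (gonalSpan S) × EdgeOfGone a b C
    span-edges-gonal a b e =
      let ((C , ab∈C) , a∈ , _) = dec-true⁻¹ (gonalEdge? a b ×-dec a ∈? S ×-dec b ∈? S) e
      in C , goneIn-span C a∈ (edgeOfGone-src C ab∈C) , ab∈C

    span-verts-gonal : v ≢ u → v ∈ S → u ∈ S →
                       Σ (Gone G k) λ C → GoneIn C (gonalSpan S) × OnGone v C
    span-verts-gonal v≢u v∈ u∈ =
      let (C , v∈C) = star-firstGone v≢u (class-star v∈ u∈)
      in C , goneIn-span C v∈ v∈C , v∈C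

    span-maximal : u ∈ S → ∀ H → Connected H → KGonal G k H → gonalSpan S ⊑ H → H ⊑ gonalSpan S
    span-maximal {u = u} u∈ H H-conn H-gonal (S⊆H , _) = H⊆S , H-edges⊆
      where
      H⊆S : ∀ v → v ∈ verts H → v ∈ S
      H⊆S v v∈ = class-closed u∈
        (kGonal-path⇒star H H-gonal (connected-path H H-conn (S⊆H u u∈) v∈))
      H-edges⊆ : ∀ a b → EdgeIn H a b → EdgeIn (gonalSpan S) a b
      H-edges⊆ a b e =
        let (C , _ , ab∈C) = proj₂ H-gonal a b e
        in dec-true (gonalEdge? a b ×-dec a ∈? S ×-dec b ∈? S)
             ((C , ab∈C) , H⊆S a (edge-src H a b e) , H⊆S b (edge-src H b a (edgeIn-sym H e)))

  nontrivialClass⇒maximal : ∀ {S} → NontrivialClass G k S → MaxConnKGonal G k (gonalSpan S)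
  nontrivialClass⇒maximal {S} (S-class , (v₁ , v₂ , v₁∈ , v₂∈ , v₁≢v₂)) =
    span-connected S-class v₁∈ ,
    (verts-gonal , span-edges-gonal S-class) ,
    span-maximal S-class v₁∈
    where
    verts-gonal : ∀ a → a ∈ S → Σ (Gone G k) λ C → GoneIn C (gonalSpan S) × OnGone a C
    verts-gonal a a∈ with a ≟ v₁
    ... | yes refl = span-verts-gonal S-class v₁≢v₂ v₁∈ v₂∈
    ... | no a≢v₁  = span-verts-gonal S-class a≢v₁ a∈ v₁∈

-- The hypothesis 3 ≤ k is unused: for k < 3 there are no (k)-gones and both sides are uninhabited.
theorem10 : ∀ {n} (G : Graph n) (k : ℕ) → 3 ≤ k → (S : Subset n) →
    (Σ (Subgraph G) (λ H → MaxConnKGonal G k H × verts H ≡ S)) ⇔ NontrivialClass G k S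
theorem10 G k _ S = mk⇔
  (λ { (H , H-max , refl) → maximal⇒nontrivialClass G k H H-max })
  (λ S-class → gonalSpan G k S , nontrivialClass⇒maximal G k S-class , refl)
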